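{- Let $\mathcal L$ be a pre-reversible combined LTSI. Then for any forward events $e,e'$ exactly one of the following holds: (1) $e=e'$; (2) $e<e'$; (3) $e'<e$; (4) $e\,\#\,e'$; (5) $e\,\iota_c\,e'$.
   Context: Setting. $\mathrm{Lab}$ is a set of labels and $\overline{\mathrm{Lab}}=\{\overline a: a\in\mathrm{Lab}\}$ a disjoint copy (reverse labels), with $\overline{\overline a}=a$. A combined LTSI $(\mathrm{Proc},\mathrm{Lab},\to,\iota)$ consists of a set $\mathrm{Proc}$ of processes, a set of forward transitions $(P,a,Q)$ with $a\in\mathrm{Lab}$, the set $\to$ of all transitions, consisting of the forward transitions together with, for each forward transition $(P,a,Q)$, the backward transition $(Q,\overline a,P)$, and an irreflexive symmetric relation $\iota$ on transitions. Write $t:P\xrightarrow{\alpha}Q$ for $t=(P,\alpha,Q)$ and $\overline t=(Q,\overline\alpha,P)$. A path is a finite (possibly empty) sequence of consecutive transitions. A process is irreversible if it is the source of no backward transition; a path is rooted if it starts at an irreversible process. Transitions are coinitial if they have the same source. Axioms. SP: whenever $t:P\xrightarrow{\alpha}Q$, $u:P\xrightarrow{\beta}R$, $t\,\iota\,u$, there are $u':Q\xrightarrow{\beta}S$, $t':R\xrightarrow{\alpha}S$. BTI: distinct backward transitions with the same source are independent. WF: no infinite sequence $P_0,P_1,\dots$ with forward transitions $P_{i+1}\xrightarrow{a_i}P_i$ for all $i$. PCI: if $t:P\xrightarrow{\alpha}Q$, $u:P\xrightarrow{\beta}R$, $u':Q\xrightarrow{\beta}S$, $t':R\xrightarrow{\alpha}S$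 and $t\,\iota\,u$, then $u'\,\iota\,\overline t$. Pre-reversible means SP, BTI, WF and PCI hold. Events: $\sim$ is the smallest equivalence relation on transitions such that whenever $t:P\xrightarrow{\alpha}Q$, $u:P\xrightarrow{\beta}R$, $u':Q\xrightarrow{\beta}S$, $t':R\xrightarrow{\alpha}S$ with $t\,\iota\,u$, $\overline u\,\iota\,t'$, $\overline{t'}\,\iota\,\overline{u'}$, $u'\,\iota\,\overline t$, and with $Q\ne R$ if $\alpha,\beta$ are both forward or both reverse labels and $P\ne S$ otherwise, then $t\sim t'$. Events are the classes $[t]$; $\overline{[t]}=[\overline t]$; forward events are classes of forward transitions. $\sharp(r,e)$ is the number of transitions $t$ in $r$ with $[t]=e$ minus the number with $[t]=\overline e$. Relations on forward events: $e\le e'$ iff for every rooted path $r$, $\sharp(r,e')>0$ implies $\sharp(r,e)>0$; $e<e'$ iff $e\le e'$ and $e\ne e'$. $e\,\#\,e'$ (conflict) iff there is no rooted path $r$ with $\sharp(r,e)>0$ and $\sharp(r,e')>0$. $e\,\iota_c\,e'$ (coinitial independence) iff there are coinitial transitions $t,t'$ with $[t]=e$, $[t']=e'$ and $t\,\iota\,t'$. -}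

module Defs where

open import Level using (0ℓ)
open import Data.Nat using (ℕ; suc)
open import Data.Integer using (ℤ; +_; _+_; _-_; _<_)
open import Data.Product using (Σ; ∃; ∃-syntax; _×_; _,_)
open import Data.Sum using (_⊎_)
open import Relation.Nullary using (¬_)
open import Relation.Binary.PropositionalEquality using (_≡_; _≢_)

data Label (Lab : Set) : Set where
  fw : Lab → Label Lab
  bw : Lab → Label Lab

flipL : {Lab : Set} → Label Lab → Label Lab
flipL (fw a) = bw a
flipL (bw a) = fw a

Triple : Set → Set → Set
Triple Proc Lab = Proc × Label Lab × Proc

rev : {Proc Lab : Set} → Triple Proc Lab → Triple Proc Lab
rev (P , α , Q) = (Q , flipL α , P)

record LTSI : Set₁ where
  field
    Proc : Set
    Lab  : Set
    Fwd  : Proc → Lab → Proc → Set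
    ι    : Triple Proc Lab → Triple Proc Lab → Set
    ι-irrefl : ∀ t → ¬ ι t t
    ι-sym    : ∀ t u → ι t u → ι u t

  Tr : Triple Proc Lab → Set
  Tr (P , fw a , Q) = Fwd P a Q
  Tr (P , bw a , Q) = Fwd Q a P

  SP : Set
  SP = ∀ P Q R α β → Tr (P , α , Q) → Tr (P , β , R) → ι (P , α , Q) (P , β , R) →
       ∃[ S ] (Tr (Q , β , S) × Tr (R , α , S))

  BTI : Set
  BTI = ∀ P Q R a b → Tr (P , bw a , Q) → Tr (P , bw b , R) →
        _≢_ {A = Triple Proc Lab} (P , bw a , Q) (P , bw b , R) → ι (P , bw a , Q) (P , bw b , R)

  WF : Set
  WF = ¬ (Σ (ℕ → Proc) λ p → Σ (ℕ → Lab) λ a → ∀ i → Fwd (p (suc i)) (a i) (p i))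

  PCI : Set
  PCI = ∀ P Q R S α β → Tr (P , α , Q) → Tr (P , β , R) → Tr (Q , β , S) → Tr (R , α , S) →
        ι (P , α , Q) (P , β , R) → ι (Q , β , S) (rev (P , α , Q))

  PreReversible : Set
  PreReversible = SP × BTI × WF × PCI

  NonDeg : Proc → Proc → Proc → Proc → Label Lab → Label Lab → Set
  NonDeg P Q R S α β with α | β
  ... | fw _ | fw _ = Q ≢ R
  ... | bw _ | bw _ = Q ≢ R
  ... | fw _ | bw _ = P ≢ S
  ... | bw _ | fw _ = P ≢ S

  data _∼_ : Triple Proc Lab → Triple Proc Lab → Set where
    ∼refl  : ∀ {t} → t ∼ t
    ∼sym   : ∀ {t u} → t ∼ u → u ∼ t
    ∼trans : ∀ {t u v} → t ∼ u → u ∼ v → t ∼ v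
    ∼sq    : ∀ {P Q R S α β} →
             Tr (P , α , Q) → Tr (P , β , R) → Tr (Q , β , S) → Tr (R , α , S) →
             ι (P , α , Q) (P , β , R) →
             ι (rev (P , β , R)) (R , α , S) →
             ι (rev (R , α , S)) (rev (Q , β , S)) →
             ι (Q , β , S) (rev (P , α , Q)) →
             NonDeg P Q R S α β →
             (P , α , Q) ∼ (R , α , S)

  data Path : Proc → Proc → Set where
    []  : ∀ {P} → Path P P
    _∷_ : ∀ {P Q R} {α : Label Lab} → Tr (P , α , Q) → Path Q R → Path P R

  Irreversible : Proc → Set
  Irreversible P = ∀ a Q → ¬ Tr (P , bw a , Q)

  -- Count r e n : "♯(r,[e]) = n", where events are represented by transitions
  -- (equality of events is ∼).
  data Count : ∀ {P R} → Path P R → Triple Proc Lab → ℤ → Set where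
    c[]   : ∀ {P e} → Count ([] {P}) e (+ 0)
    cPos  : ∀ {P Q R α e n} {t : Tr (P , α , Q)} {r : Path Q R} →
            (P , α , Q) ∼ e → ¬ ((P , α , Q) ∼ rev e) →
            Count r e n → Count (_∷_ {P} {Q} {R} {α} t r) e (n + + 1)
    cNeg  : ∀ {P Q R α e n} {t : Tr (P , α , Q)} {r : Path Q R} →
            ¬ ((P , α , Q) ∼ e) → (P , α , Q) ∼ rev e →
            Count r e n → Count (_∷_ {P} {Q} {R} {α} t r) e (n - + 1)
    cNone : ∀ {P Q R α e n} {t : Tr (P , α , Q)} {r : Path Q R} →
            ¬ ((P , α , Q) ∼ e) → ¬ ((P , α , Q) ∼ rev e) →
            Count r e n → Count (_∷_ {P} {Q} {R} {α} t r) e n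
    cBoth : ∀ {P Q R α e n} {t : Tr (P , α , Q)} {r : Path Q R} →
            (P , α , Q) ∼ e → (P , α , Q) ∼ rev e →
            Count r e n → Count (_∷_ {P} {Q} {R} {α} t r) e n

  Pos : ∀ {P R} → Path P R → Triple Proc Lab → Set
  Pos r e = ∃[ n ] (Count r e n × + 0 < n)

  _≤ₑ_ : Triple Proc Lab → Triple Proc Lab → Set
  e ≤ₑ e' = ∀ P R → Irreversible P → (r : Path P R) → Pos r e' → Pos r e

  _<ₑ_ : Triple Proc Lab → Triple Proc Lab → Set
  e <ₑ e' = (e ≤ₑ e') × ¬ (e ∼ e')

  _#_ : Triple Proc Lab → Triple Proc Lab → Set
  e # e' = ¬ (Σ Proc λ P → Σ Proc λ R → Σ (Path P R) λ r →
              Irreversible P × Pos r e × Pos r e')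

  _ιc_ : Triple Proc Lab → Triple Proc Lab → Set
  e ιc e' = Σ Proc λ P → Σ (Label Lab) λ α → Σ Proc λ Q → Σ (Label Lab) λ β → Σ Proc λ R →
            Tr (P , α , Q) × Tr (P , β , R) ×
            (P , α , Q) ∼ e × (P , β , R) ∼ e' × ι (P , α , Q) (P , β , R)

ExactlyOne5 : Set → Set → Set → Set → Set → Set
ExactlyOne5 A B C D E =
  (A ⊎ B ⊎ C ⊎ D ⊎ E) ×
  ¬ (A × B) × ¬ (A × C) × ¬ (A × D) × ¬ (A × E) ×
  ¬ (B × C) × ¬ (B × D) × ¬ (B × E) ×
  ¬ (C × D) × ¬ (C × E) ×
  ¬ (D × E)

{-# OPTIONS --safe #-}

-- By well-foundedness every process is reached by a forward path from an
-- irreversible one, and by the parabolic lemma (push forward steps through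
-- backward ones, using BTI and SP) the net count ♯(r, e) along a rooted path r
-- depends only on its endpoint X; call it countAt X e.  A square generating ∼
-- moves an occurrence of e along a step coinitially independent of it, so if e
-- and g are not coinitially independent, g has the same count at the sources of
-- all occurrences of e.  For distinct forward events that are neither in
-- conflict nor coinitially independent, comparing their first occurrences
-- along a rooted path shows that one of them precedes the other; the
-- exclusivity of the five cases follows from the same counting facts.

module Submission where

open import Defs
open import Level using (0ℓ)
open import Data.Product using (_,_)
open import Axiom.ExcludedMiddle using (ExcludedMiddle)

open import Data.Bool using (if_then_else_)
open import Data.Empty using (⊥; ⊥-elim)
open import Data.Integer using (ℤ; +_; _+_; _-_; -_; _<_; _≤_; +≤+; +<+)
import Data.Integer.Properties as ℤ
open import Algebra.Properties.CommutativeSemigroup ℤ.+-commutativeSemigroup using (xy∙z≈xz∙y)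
open import Data.Integer.Tactic.RingSolver using (solve-∀)
open import Data.Nat using (ℕ; zero; suc; z≤n; s≤s)
open import Data.Product using (Σ; ∃; _×_; proj₁; proj₂; uncurry)
open import Data.Sum using (_⊎_; inj₁; inj₂)
open import Function using (_∘_; case_of_)
open import Relation.Nullary using (¬_; Dec; yes; no; does)
open import Relation.Nullary.Decidable using (decidable-stable; dec-true; dec-false)
open import Relation.Binary.PropositionalEquality

module Events (L : LTSI) where
  open LTSI L

  Transition : Set
  Transition = Triple Proc Lab

  private variable
    P Q R S X Y Z W O P′ Q′ O′ : Proc
    a b a′ : Lab
    α β : Label Lab
    x y e e′ g : Transition

  src : Transition → Proc
  src (P , _ , _) = P

  label : Transition → Label Lab
  label (_ , α , _) = α

  flipL-involutive : (α : Label Lab) → flipL (flipL α) ≡ α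
  flipL-involutive (fw a) = refl
  flipL-involutive (bw a) = refl

  flipL-≢ : (α : Label Lab) → flipL α ≢ α
  flipL-≢ (fw a) ()
  flipL-≢ (bw a) ()

  rev-involutive : (x : Transition) → rev (rev x) ≡ x
  rev-involutive (P , α , Q) = cong (λ γ → P , γ , Q) (flipL-involutive α)

  Tr-rev : (x : Transition) → Tr x → Tr (rev x)
  Tr-rev (P , fw a , Q) t = t
  Tr-rev (P , bw a , Q) t = t

  NonDeg-sym : NonDeg P Q R S α β → NonDeg P R Q S β α
  NonDeg-sym {α = fw _} {β = fw _} nd = nd ∘ sym
  NonDeg-sym {α = fw _} {β = bw _} nd = nd
  NonDeg-sym {α = bw _} {β = fw _} nd = nd
  NonDeg-sym {α = bw _} {β = bw _} nd = nd ∘ sym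

  NonDeg-rev : NonDeg P Q R S α β → NonDeg Q P S R (flipL α) β
  NonDeg-rev {α = fw _} {β = fw _} nd = nd
  NonDeg-rev {α = fw _} {β = bw _} nd = nd
  NonDeg-rev {α = bw _} {β = fw _} nd = nd
  NonDeg-rev {α = bw _} {β = bw _} nd = nd

  ∼-label : x ∼ y → label x ≡ label y
  ∼-label ∼refl = refl
  ∼-label (∼sym p) = sym (∼-label p)
  ∼-label (∼trans p q) = trans (∼-label p) (∼-label q)
  ∼-label (∼sq _ _ _ _ _ _ _ _ _) = refl

  ∼⇒≁rev : x ∼ y → ¬ x ∼ rev y
  ∼⇒≁rev {y = y} p q = flipL-≢ (label y) (trans (sym (∼-label q)) (∼-label p))

  ∼-rev : x ∼ y → rev x ∼ rev y
  ∼-rev ∼refl = ∼refl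
  ∼-rev (∼sym p) = ∼sym (∼-rev p)
  ∼-rev (∼trans p q) = ∼trans (∼-rev p) (∼-rev q)
  ∼-rev (∼sq {P} {Q} {R} {S} {α} {β} t u u′ t′ c₁ c₂ c₃ c₄ nd) =
    ∼sq (Tr-rev (P , α , Q) t) u′ u (Tr-rev (R , α , S) t′) (ι-sym _ _ c₄) (ι-sym _ _ c₃)
      (subst (λ x → ι x (R , flipL β , P)) (sym (rev-involutive (R , α , S))) (ι-sym _ _ c₂))
      (subst (ι (P , β , R)) (sym (rev-involutive (P , α , Q))) (ι-sym _ _ c₁))
      (NonDeg-rev nd)

  ∼-rev⁻¹ : rev x ∼ rev y → x ∼ y
  ∼-rev⁻¹ {x} {y} p = subst₂ _∼_ (rev-involutive x) (rev-involutive y) (∼-rev p)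

  rev∼⇒∼rev : rev x ∼ y → x ∼ rev y
  rev∼⇒∼rev {x} {y} p = ∼-rev⁻¹ (subst (rev x ∼_) (sym (rev-involutive y)) p)

  ∼rev⇒rev∼ : x ∼ rev y → rev x ∼ y
  ∼rev⇒rev∼ {y = y} p = subst (_ ∼_) (rev-involutive y) (∼-rev p)

  ιc-sym : e ιc e′ → e′ ιc e
  ιc-sym (P , α , Q , β , R , t , u , t∼e , u∼e′ , i) = P , β , R , α , Q , u , t , u∼e′ , t∼e , ι-sym _ _ i

  #-sym : e # e′ → e′ # e
  #-sym h (P , R , r , irr , pos , pos′) = h (P , R , r , irr , pos′ , pos)

  module _ (wf : WF) where

    no-infinite-descent : (Bad : Proc → Set) →
                          (∀ {X} → Bad X → Σ Proc λ Y → Σ Lab λ a → Fwd Y a X × Bad Y) →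
                          ∀ X → ¬ Bad X
    no-infinite-descent Bad descend X bad = wf (proj₁ ∘ chain , label-at , step-at)
      where
        chain : ℕ → Σ Proc Bad
        chain zero    = X , bad
        chain (suc i) = let (Y , _ , _ , badY) = descend (proj₂ (chain i)) in Y , badY

        label-at : ℕ → Lab
        label-at i = proj₁ (proj₂ (descend (proj₂ (chain i))))

        step-at : ∀ i → Fwd (proj₁ (chain (suc i))) (label-at i) (proj₁ (chain i))
        step-at i = proj₁ (proj₂ (proj₂ (descend (proj₂ (chain i)))))

  module _ (sp : SP) (bti : BTI) (wf : WF) where

    -- Two backward steps out of Y are independent (BTI) and close a square (SP)
    -- whose far corner is again the source of two parallel steps: an infinite descent.
    no-parallel : a ≢ b → Fwd X a Y → Fwd X b Y → ⊥
    no-parallel {a} {b} {X} {Y} a≢b s t =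
      no-infinite-descent wf Parallel descend X (Y , a , b , a≢b , s , t)
      where
        Parallel : Proc → Set
        Parallel V = Σ Proc λ U → Σ Lab λ a → Σ Lab λ b → a ≢ b × Fwd V a U × Fwd V b U

        descend : ∀ {V} → Parallel V → Σ Proc λ Z → Σ Lab λ a → Fwd Z a V × Parallel Z
        descend {V} (U , a , b , a≢b , s , t) =
          let (Z , t′ , s′) = sp U V V (bw a) (bw b) s t (bti U V V a b s t λ { refl → a≢b refl })
          in Z , a , s′ , V , a , b , a≢b , s′ , t′

  module _ (sp : SP) (pci : PCI) where

    -- Propagating ι twice around the square of t and u yields ι t t.
    ¬ι-coinitial-same-label : Tr (P , α , Q) → Tr (P , α , R) → ¬ ι (P , α , Q) (P , α , R)
    ¬ι-coinitial-same-label {P} {α} {Q} {R} t u i =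
      let (S , u′ , t′) = sp P Q R α α t u i
          k = pci P Q R S α α t u u′ t′ i
          j = pci Q P S Q (flipL α) α (Tr-rev (P , α , Q) t) u′ t (Tr-rev (Q , α , S) u′) (ι-sym _ _ k)
      in ι-irrefl _ (subst (λ γ → ι (P , α , Q) (P , γ , Q)) (flipL-involutive α) j)

    ιc-irrefl : ¬ (e ιc e)
    ιc-irrefl (P , α , Q , β , R , t , u , t∼e , u∼e , i)
      with trans (∼-label t∼e) (sym (∼-label u∼e))
    ... | refl = ¬ι-coinitial-same-label t u i

    ∼⇒¬ιc : e ∼ e′ → ¬ (e ιc e′)
    ∼⇒¬ιc e∼e′ (P , α , Q , β , R , t , u , t∼e , u∼e′ , i) =
      ιc-irrefl (P , α , Q , β , R , t , u , t∼e , ∼trans u∼e′ (∼sym e∼e′) , i)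

  data _⇝_ : Proc → Proc → Set where
    [] : X ⇝ X
    _∷_ : Fwd X a Y → Y ⇝ Z → X ⇝ Z

  data _⇜_ : Proc → Proc → Set where
    [] : X ⇜ X
    _∷_ : Fwd Y a X → Y ⇜ Z → X ⇜ Z

  ⇝⇒Path : X ⇝ Y → Path X Y
  ⇝⇒Path [] = []
  ⇝⇒Path (_∷_ {a = a} s f) = _∷_ {α = fw a} s (⇝⇒Path f)

  ⇜⇒Path : X ⇜ Y → Path X Y
  ⇜⇒Path [] = []
  ⇜⇒Path (_∷_ {a = a} t b) = _∷_ {α = bw a} t (⇜⇒Path b)

  infixr 5 _++_ _++ᶠ_

  _++_ : Path X Y → Path Y Z → Path X Z
  [] ++ s = s
  (_∷_ {α = α} t r) ++ s = _∷_ {α = α} t (r ++ s)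

  ++-assoc : (r : Path X Y) (s : Path Y Z) (q : Path Z W) → (r ++ s) ++ q ≡ r ++ (s ++ q)
  ++-assoc [] s q = refl
  ++-assoc (_∷_ {α = α} t r) s q = cong (_∷_ {α = α} t) (++-assoc r s q)

  _++ᶠ_ : X ⇝ Y → Y ⇝ Z → X ⇝ Z
  [] ++ᶠ g = g
  (s ∷ f) ++ᶠ g = s ∷ (f ++ᶠ g)

  ⇝⇒Path-++ᶠ : (f : X ⇝ Y) (g : Y ⇝ Z) → ⇝⇒Path (f ++ᶠ g) ≡ ⇝⇒Path f ++ ⇝⇒Path g
  ⇝⇒Path-++ᶠ [] g = refl
  ⇝⇒Path-++ᶠ (_∷_ {a = a} s f) g = cong (_∷_ {α = fw a} s) (⇝⇒Path-++ᶠ f g)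

  reverse : Path X Y → Path Y X
  reverse [] = []
  reverse (_∷_ {X} {Y} {α = α} t r) = reverse r ++ (_∷_ {α = flipL α} (Tr-rev (X , α , Y) t) [])

  record Rooted (X : Proc) : Set where
    constructor rooted-by
    field
      {root} : Proc
      root-irreversible : Irreversible root
      path : root ⇝ X

  ⇝-irreversible : Irreversible O → Fwd X a Y → ¬ (Y ⇝ O)
  ⇝-irreversible irr s [] = irr _ _ s
  ⇝-irreversible irr s (s′ ∷ f) = ⇝-irreversible irr s′ f

  module _ (em : ExcludedMiddle 0ℓ) where

    𝟙 : Set → ℤ
    𝟙 A = if does (em {A}) then + 1 else + 0

    𝟙-yes : {A : Set} → A → 𝟙 A ≡ + 1
    𝟙-yes a = cong (if_then + 1 else + 0) (dec-true em a)

    𝟙-no : {A : Set} → ¬ A → 𝟙 A ≡ + 0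
    𝟙-no ¬a = cong (if_then + 1 else + 0) (dec-false em ¬a)

    𝟙-cong : {A B : Set} → (A → B) → (B → A) → 𝟙 A ≡ 𝟙 B
    𝟙-cong {A} f g = case em {A} of λ where
      (yes a) → trans (𝟙-yes a) (sym (𝟙-yes (f a)))
      (no ¬a) → trans (𝟙-no ¬a) (sym (𝟙-no (¬a ∘ g)))

    weight : Transition → Transition → ℤ
    weight x e = 𝟙 (x ∼ e) - 𝟙 (x ∼ rev e)

    weight-congˡ : x ∼ y → weight x e ≡ weight y e
    weight-congˡ x∼y = cong₂ _-_ (𝟙-cong (∼trans (∼sym x∼y)) (∼trans x∼y))
                                 (𝟙-cong (∼trans (∼sym x∼y)) (∼trans x∼y))

    weight-rev : weight (rev x) e ≡ - weight x e
    weight-rev {x} {e} = begin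
      𝟙 (rev x ∼ e) - 𝟙 (rev x ∼ rev e) ≡⟨ cong₂ _-_ (𝟙-cong rev∼⇒∼rev ∼rev⇒rev∼) (𝟙-cong ∼-rev⁻¹ ∼-rev) ⟩
      𝟙 (x ∼ rev e) - 𝟙 (x ∼ e)         ≡⟨ minus-swap (𝟙 (x ∼ e)) (𝟙 (x ∼ rev e)) ⟩
      - weight x e                      ∎
      where
        open ≡-Reasoning
        minus-swap : ∀ i j → j - i ≡ - (i - j)
        minus-swap = solve-∀

    weight-∼ : x ∼ e → weight x e ≡ + 1
    weight-∼ x∼e = cong₂ _-_ (𝟙-yes x∼e) (𝟙-no (∼⇒≁rev x∼e))

    weight-∼rev : x ∼ rev e → weight x e ≡ - + 1
    weight-∼rev x∼e̅ = cong₂ _-_ (𝟙-no (λ x∼e → ∼⇒≁rev x∼e x∼e̅)) (𝟙-yes x∼e̅)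

    weight-≁ : ¬ x ∼ e → ¬ x ∼ rev e → weight x e ≡ + 0
    weight-≁ x≁e x≁e̅ = cong₂ _-_ (𝟙-no x≁e) (𝟙-no x≁e̅)

    fwd≁rev-fwd : ¬ (X , fw b , Y) ∼ rev (P , fw a , Q)
    fwd≁rev-fwd p with ∼-label p
    ... | ()

    weight-fwd-≁ : ¬ (X , fw b , Y) ∼ (P , fw a , Q) → weight (X , fw b , Y) (P , fw a , Q) ≡ + 0
    weight-fwd-≁ x≁e = weight-≁ x≁e fwd≁rev-fwd

    weight-fwd-nonneg : + 0 ≤ weight (X , fw b , Y) (P , fw a , Q)
    weight-fwd-nonneg {X} {b} {Y} {P} {a} {Q} = case em {(X , fw b , Y) ∼ (P , fw a , Q)} of λ where
      (yes x∼e) → ℤ.≤-trans (+≤+ z≤n) (ℤ.≤-reflexive (sym (weight-∼ x∼e)))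
      (no x≁e)  → ℤ.≤-reflexive (sym (weight-fwd-≁ x≁e))

    count : Path X Y → Transition → ℤ
    count [] e = + 0
    count (_∷_ {X} {Y} {α = α} t r) e = count r e + weight (X , α , Y) e

    _≋_ : Path X Y → Path Z W → Set
    r ≋ s = ∀ e → count r e ≡ count s e

    count-++ : (r : Path X Y) (s : Path Y Z) (e : Transition) → count (r ++ s) e ≡ count r e + count s e
    count-++ [] s e = sym (ℤ.+-identityˡ _)
    count-++ (_∷_ {X} {Y} {α = α} t r) s e =
      trans (cong (_+ weight (X , α , Y) e) (count-++ r s e)) (xy∙z≈xz∙y (count r e) (count s e) _)

    count-reverse : (r : Path X Y) (e : Transition) → count (reverse r) e ≡ - count r e
    count-reverse [] e = refl
    count-reverse (_∷_ {X} {Y} {α = α} t r) e = begin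
      count (reverse r ++ _) e                 ≡⟨ count-++ (reverse r) _ e ⟩
      count (reverse r) e + (+ 0 + weight (rev (X , α , Y)) e)
                                               ≡⟨ cong₂ _+_ (count-reverse r e) (trans (ℤ.+-identityˡ _) weight-rev) ⟩
      - count r e + - weight (X , α , Y) e     ≡⟨ ℤ.neg-distrib-+ (count r e) _ ⟨
      - (count r e + weight (X , α , Y) e)     ∎
      where open ≡-Reasoning

    count-⇝-nonneg : (f : X ⇝ Y) → + 0 ≤ count (⇝⇒Path f) (P , fw a , Q)
    count-⇝-nonneg [] = ℤ.≤-refl
    count-⇝-nonneg (s ∷ f) = ℤ.+-mono-≤ (count-⇝-nonneg f) weight-fwd-nonneg

    Count⇒count : {r : Path X Y} {n : ℤ} → Count r e n → n ≡ count r e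
    Count⇒count c[] = refl
    Count⇒count (cPos x∼e _ c) = cong₂ _+_ (Count⇒count c) (sym (weight-∼ x∼e))
    Count⇒count (cNeg _ x∼e̅ c) = cong₂ _+_ (Count⇒count c) (sym (weight-∼rev x∼e̅))
    Count⇒count {e = e} {r = _ ∷ r} (cNone x≁e x≁e̅ c) =
      trans (Count⇒count c) (trans (sym (ℤ.+-identityʳ _)) (cong (_+_ (count r e)) (sym (weight-≁ x≁e x≁e̅))))
    Count⇒count (cBoth x∼e x∼e̅ _) = ⊥-elim (∼⇒≁rev x∼e x∼e̅)

    Count-total : (r : Path X Y) (e : Transition) → ∃ (Count r e)
    Count-total [] e = _ , c[]
    Count-total (_∷_ {X} {Y} {α = α} t r) e
      with Count-total r e | em {(X , α , Y) ∼ e} | em {(X , α , Y) ∼ rev e}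
    ... | _ , c | yes x∼e | yes x∼e̅ = _ , cBoth x∼e x∼e̅ c
    ... | _ , c | yes x∼e | no x≁e̅  = _ , cPos x∼e x≁e̅ c
    ... | _ , c | no x≁e  | yes x∼e̅ = _ , cNeg x≁e x∼e̅ c
    ... | _ , c | no x≁e  | no x≁e̅  = _ , cNone x≁e x≁e̅ c

    Pos⇒0<count : (r : Path X Y) → Pos r e → + 0 < count r e
    Pos⇒0<count r (n , c , 0<n) = subst (+ 0 <_) (Count⇒count c) 0<n

    0<count⇒Pos : (r : Path X Y) → + 0 < count r e → Pos r e
    0<count⇒Pos {e = e} r 0<count =
      let (n , c) = Count-total r e in n , c , subst (+ 0 <_) (sym (Count⇒count c)) 0<count

    rooted : WF → ∀ X → Rooted X
    rooted wf X = decidable-stable em (no-infinite-descent wf (¬_ ∘ Rooted) ancestor X)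
      where
        ancestor : ∀ {V} → ¬ Rooted V → Σ Proc λ U → Σ Lab λ a → Fwd U a V × ¬ Rooted U
        ancestor {V} ¬rV = case em {Σ Proc λ U → Σ Lab λ a → Fwd U a V} of λ where
          (yes (U , a , s)) → U , a , s , λ (rooted-by irr f) → ¬rV (rooted-by irr (f ++ᶠ (s ∷ [])))
          (no ¬s)           → ⊥-elim (¬rV (rooted-by (λ a U s → ¬s (U , a , s)) []))

    module Classification (sp : SP) (bti : BTI) (wf : WF) (pci : PCI) where

      square-nondegenerate : Tr (P , α , Q) → Tr (P , β , R) → Tr (Q , β , S) → Tr (R , α , S) →
                             ι (P , α , Q) (P , β , R) → NonDeg P Q R S α β
      square-nondegenerate {α = fw a} {β = fw b} t u _ _ i refl =
        no-parallel sp bti wf (λ { refl → ι-irrefl _ i }) t u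
      square-nondegenerate {α = bw a} {β = bw b} t u _ _ i refl =
        no-parallel sp bti wf (λ { refl → ι-irrefl _ i }) t u
      square-nondegenerate {P} {fw a} {Q} {bw b} {R} t u u′ t′ i refl with em {a ≡ b}
      ... | yes refl = ι-irrefl _ (pci P Q R P (fw a) (bw a) t u u′ t′ i)
      ... | no a≢b   = no-parallel sp bti wf a≢b t u′
      square-nondegenerate {P} {bw a} {Q} {fw b} {R} t u u′ t′ i refl with em {a ≡ b}
      ... | yes refl = ι-irrefl _ (pci P Q R P (bw a) (fw a) t u u′ t′ i)
      ... | no a≢b   = no-parallel sp bti wf a≢b t u′

      record Square (P Q R : Proc) (α β : Label Lab) : Set where
        field
          {corner} : Proc
          u′ : Tr (Q , β , corner)
          t′ : Tr (R , α , corner)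
          t∼t′ : (P , α , Q) ∼ (R , α , corner)
          u∼u′ : (P , β , R) ∼ (Q , β , corner)

      square : Tr (P , α , Q) → Tr (P , β , R) → ι (P , α , Q) (P , β , R) → Square P Q R α β
      square {P} {α} {Q} {β} {R} t u i with sp P Q R α β t u i
      ... | V , u′ , t′ = record
        { u′ = u′ ; t′ = t′
        ; t∼t′ = ∼sq t u u′ t′ i c₂ c₃ c₄ nd
        ; u∼u′ = ∼sq u t t′ u′ (ι-sym _ _ i) (ι-sym _ _ c₄) (ι-sym _ _ c₃) (ι-sym _ _ c₂) (NonDeg-sym nd)
        }
        where
          c₄ : ι (Q , β , V) (rev (P , α , Q))
          c₄ = pci P Q R V α β t u u′ t′ i
          c₃ : ι (rev (R , α , V)) (rev (Q , β , V))
          c₃ = pci Q V P R β (flipL α) u′ (Tr-rev (P , α , Q) t) (Tr-rev (R , α , V) t′) u c₄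
          c₂ : ι (rev (P , β , R)) (R , α , V)
          c₂ = subst (ι (rev (P , β , R))) (rev-involutive (R , α , V))
                 (pci V R Q P (flipL α) (flipL β) (Tr-rev (R , α , V) t′) (Tr-rev (Q , β , V) u′)
                      (Tr-rev (P , β , R) u) (Tr-rev (P , α , Q) t) c₃)
          nd : NonDeg P Q R V α β
          nd = square-nondegenerate t u u′ t′ i

      -- The parabolic lemma and the count at a process

      record Parabolic {X Y : Proc} (r : Path X Y) : Set where
        field
          {apex} : Proc
          back : X ⇜ apex
          forth : apex ⇝ Y
          count-≋ : r ≋ (⇜⇒Path back ++ ⇝⇒Path forth)

      push : (s : Fwd X a Y) (b : Y ⇜ Z) → Parabolic (⇝⇒Path (s ∷ []) ++ ⇜⇒Path b)
      push s [] = record { back = [] ; forth = s ∷ [] ; count-≋ = λ _ → refl }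
      push {X} {a} {Y} s (_∷_ {Y = Y₁} {a = l} t b)
        with em {_≡_ {A = Transition} (Y , bw a , X) (Y , bw l , Y₁)}
      ... | yes refl = record { back = b ; forth = [] ; count-≋ = λ e → begin
        count (⇜⇒Path b) e + weight (rev (X , fw a , Y)) e + weight (X , fw a , Y) e
          ≡⟨ cong (λ w → count (⇜⇒Path b) e + w + weight (X , fw a , Y) e) weight-rev ⟩
        count (⇜⇒Path b) e + - weight (X , fw a , Y) e + weight (X , fw a , Y) e
          ≡⟨ ℤ.+-assoc (count (⇜⇒Path b) e) _ _ ⟩
        count (⇜⇒Path b) e + (- weight (X , fw a , Y) e + weight (X , fw a , Y) e)
          ≡⟨ cong (_+_ (count (⇜⇒Path b) e)) (ℤ.+-inverseˡ (weight (X , fw a , Y) e)) ⟩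
        count (⇜⇒Path b) e + + 0
          ≡⟨ count-++ (⇜⇒Path b) [] e ⟨
        count (⇜⇒Path b ++ []) e ∎ }
        where open ≡-Reasoning
      ... | no s̅≢t with square {Y} {bw a} {X} {bw l} {Y₁} s t (bti Y X Y₁ a l s t s̅≢t)
      ... | record { corner = V ; u′ = u′ ; t′ = t′ ; t∼t′ = t∼t′ ; u∼u′ = u∼u′ } with push t′ b
      ... | record { back = b′ ; forth = f′ ; count-≋ = eq } =
        record { back = u′ ∷ b′ ; forth = f′ ; count-≋ = λ e → begin
          count (⇜⇒Path b) e + weight (Y , bw l , Y₁) e + weight (X , fw a , Y) e
            ≡⟨ cong₂ _+_ (cong (_+_ (count (⇜⇒Path b) e)) (weight-congˡ u∼u′)) (weight-congˡ (∼-rev t∼t′)) ⟩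
          count (⇜⇒Path b) e + weight (X , bw l , V) e + weight (V , fw a , Y₁) e
            ≡⟨ xy∙z≈xz∙y (count (⇜⇒Path b) e) _ _ ⟩
          count (⇜⇒Path b) e + weight (V , fw a , Y₁) e + weight (X , bw l , V) e
            ≡⟨ cong (_+ weight (X , bw l , V) e) (eq e) ⟩
          count (⇜⇒Path b′ ++ ⇝⇒Path f′) e + weight (X , bw l , V) e ∎ }
        where open ≡-Reasoning

      parabolic : (r : Path X Y) → Parabolic r
      parabolic [] = record { back = [] ; forth = [] ; count-≋ = λ _ → refl }
      parabolic (_∷_ {X} {Y} {α = bw a} t r) with parabolic r
      ... | record { back = b ; forth = f ; count-≋ = eq } =
        record { back = t ∷ b ; forth = f ; count-≋ = λ e → cong (_+ weight (X , bw a , Y) e) (eq e) }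
      parabolic (_∷_ {X} {Y} {α = fw a} s r) with parabolic r
      ... | record { back = b ; forth = f ; count-≋ = eq } with push s b
      ... | record { back = b′ ; forth = f′ ; count-≋ = eq′ } =
        record { back = b′ ; forth = f′ ++ᶠ f ; count-≋ = λ e → begin
          count r e + weight (X , fw a , Y) e
            ≡⟨ cong (_+ weight (X , fw a , Y) e) (eq e) ⟩
          count ((⇝⇒Path (s ∷ []) ++ ⇜⇒Path b) ++ ⇝⇒Path f) e
            ≡⟨ count-++ (⇝⇒Path (s ∷ []) ++ ⇜⇒Path b) (⇝⇒Path f) e ⟩
          count (⇝⇒Path (s ∷ []) ++ ⇜⇒Path b) e + count (⇝⇒Path f) e
            ≡⟨ cong (_+ count (⇝⇒Path f) e) (eq′ e) ⟩
          count (⇜⇒Path b′ ++ ⇝⇒Path f′) e + count (⇝⇒Path f) e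
            ≡⟨ count-++ (⇜⇒Path b′ ++ ⇝⇒Path f′) (⇝⇒Path f) e ⟨
          count ((⇜⇒Path b′ ++ ⇝⇒Path f′) ++ ⇝⇒Path f) e
            ≡⟨ cong (λ p → count p e) (trans (++-assoc (⇜⇒Path b′) _ _) (cong (⇜⇒Path b′ ++_) (sym (⇝⇒Path-++ᶠ f′ f)))) ⟩
          count (⇜⇒Path b′ ++ ⇝⇒Path (f′ ++ᶠ f)) e ∎ }
        where open ≡-Reasoning

      forward-representative : Irreversible O → (r : Path O X) → Σ (O ⇝ X) λ f → r ≋ ⇝⇒Path f
      forward-representative irr r with parabolic r
      ... | record { back = [] ; forth = f ; count-≋ = eq } = f , eq
      ... | record { back = t ∷ _ } = ⊥-elim (irr _ _ t)

      count-rooted-unique : Irreversible O → Irreversible O′ → (r : Path O X) (r′ : Path O′ X) → r ≋ r′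
      count-rooted-unique irr irr′ r r′ e with forward-representative irr (r ++ reverse r′)
      ... | s ∷ f , _ = ⊥-elim (⇝-irreversible irr′ s f)
      ... | [] , eq = ℤ.i-j≡0⇒i≡j (count r e) (count r′ e) (begin
        count r e - count r′ e           ≡⟨ cong (_+_ (count r e)) (count-reverse r′ e) ⟨
        count r e + count (reverse r′) e ≡⟨ count-++ r (reverse r′) e ⟨
        count (r ++ reverse r′) e        ≡⟨ eq e ⟩
        + 0                              ∎)
        where open ≡-Reasoning

      countAt : Proc → Transition → ℤ
      countAt X e = count (⇝⇒Path (Rooted.path (rooted wf X))) e

      countAt-rooted : Irreversible O → (r : Path O X) → count r e ≡ countAt X e
      countAt-rooted {X = X} {e = e} irr r =
        count-rooted-unique irr (Rooted.root-irreversible (rooted wf X)) r (⇝⇒Path (Rooted.path (rooted wf X))) e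

      countAt-root : Irreversible O → countAt O e ≡ + 0
      countAt-root irr = sym (countAt-rooted irr [])

      countAt-step : Tr (X , α , Y) → countAt Y e ≡ countAt X e + weight (X , α , Y) e
      countAt-step {X} {α} {Y} {e} t = begin
        countAt Y e                                ≡⟨ countAt-rooted (Rooted.root-irreversible ρ) (p ++ t∷[]) ⟨
        count (p ++ t∷[]) e                        ≡⟨ count-++ p t∷[] e ⟩
        countAt X e + (+ 0 + weight (X , α , Y) e) ≡⟨ cong (_+_ (countAt X e)) (ℤ.+-identityˡ _) ⟩
        countAt X e + weight (X , α , Y) e         ∎
        where
          open ≡-Reasoning
          ρ : Rooted X
          ρ = rooted wf X
          p : Path (Rooted.root ρ) X
          p = ⇝⇒Path (Rooted.path ρ)
          t∷[] : Path X Y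
          t∷[] = _∷_ {α = α} t []

      countAt-step-≁ : Tr (X , α , Y) → ¬ (X , α , Y) ∼ e → ¬ (X , α , Y) ∼ rev e → countAt Y e ≡ countAt X e
      countAt-step-≁ {X} {α} {Y} {e} t x≁e x≁e̅ =
        trans (countAt-step {X} {α} {Y} t) (trans (cong (_+_ (countAt X e)) (weight-≁ x≁e x≁e̅)) (ℤ.+-identityʳ _))

      -- In a square of ∼, the step u moving the source of t is coinitially independent
      -- of t, hence neither an occurrence of g nor of its reverse.
      countAt-src-∼ : ¬ (e ιc g) → x ∼ e → x ∼ y → countAt (src x) g ≡ countAt (src y) g
      countAt-src-∼ ¬ι x∼e ∼refl = refl
      countAt-src-∼ ¬ι x∼e (∼sym y∼x) = sym (countAt-src-∼ ¬ι (∼trans y∼x x∼e) y∼x)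
      countAt-src-∼ ¬ι x∼e (∼trans x∼z z∼y) =
        trans (countAt-src-∼ ¬ι x∼e x∼z) (countAt-src-∼ ¬ι (∼trans (∼sym x∼z) x∼e) z∼y)
      countAt-src-∼ {g = g} ¬ι t∼e (∼sq {P} {Q} {R} {S} {α} {β} t u u′ t′ c₁ c₂ c₃ c₄ nd) =
        sym (countAt-step-≁ u u≁g u≁g̅)
        where
          u≁g : ¬ (P , β , R) ∼ g
          u≁g u∼g = ¬ι (P , α , Q , β , R , t , u , t∼e , u∼g , c₁)
          u≁g̅ : ¬ (P , β , R) ∼ rev g
          u≁g̅ u∼g̅ = ¬ι (R , α , S , flipL β , P , t′ , Tr-rev (P , β , R) u ,
                         ∼trans (∼sym (∼sq t u u′ t′ c₁ c₂ c₃ c₄ nd)) t∼e , ∼rev⇒rev∼ u∼g̅ , ι-sym _ _ c₂)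

      Happened : Transition → Proc → Set
      Happened e X = + 0 < countAt X e

      happened? : ∀ e X → Dec (Happened e X)
      happened? e X = + 0 ℤ.<? countAt X e

      root-not-happened : Irreversible O → ¬ Happened e O
      root-not-happened irr = ℤ.<-irrefl (sym (countAt-root irr))

      countAt-nonneg : + 0 ≤ countAt X (P , fw a , Q)
      countAt-nonneg {X} = count-⇝-nonneg (Rooted.path (rooted wf X))

      countAt-mono : Fwd X b Y → countAt X (P , fw a , Q) ≤ countAt Y (P , fw a , Q)
      countAt-mono {X} {b} {Y} {P} {a} {Q} s = begin
        countAt X (P , fw a , Q)                                  ≡⟨ ℤ.+-identityʳ _ ⟨
        countAt X (P , fw a , Q) + + 0                            ≤⟨ ℤ.+-monoʳ-≤ (countAt X _) weight-fwd-nonneg ⟩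
        countAt X (P , fw a , Q) + weight (X , fw b , Y) (P , fw a , Q) ≡⟨ countAt-step {α = fw b} s ⟨
        countAt Y (P , fw a , Q)                                  ∎
        where open ℤ.≤-Reasoning

      happened-mono : Y ⇝ Z → Happened (P , fw a , Q) Y → Happened (P , fw a , Q) Z
      happened-mono [] h = h
      happened-mono (s ∷ f) h = happened-mono f (ℤ.<-≤-trans h (countAt-mono s))

      happened-after : Fwd X b Y → (X , fw b , Y) ∼ (P , fw a , Q) → Happened (P , fw a , Q) Y
      happened-after {X} {b} {Y} {P} {a} {Q} s s∼e = subst (+ 0 <_) (sym countAt-Y) 0<countAt-X+1
        where
          countAt-Y : countAt Y (P , fw a , Q) ≡ countAt X (P , fw a , Q) + + 1
          countAt-Y = trans (countAt-step {α = fw b} s) (cong (_+_ (countAt X _)) (weight-∼ s∼e))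
          0<countAt-X+1 : + 0 < countAt X (P , fw a , Q) + + 1
          0<countAt-X+1 = ℤ.+-mono-≤-< countAt-nonneg (+<+ (s≤s z≤n))

      happened-before : Fwd X b Y → ¬ (X , fw b , Y) ∼ (P , fw a , Q) →
                        Happened (P , fw a , Q) Y → Happened (P , fw a , Q) X
      happened-before {b = b} s s≁e = subst (+ 0 <_) (countAt-step-≁ {α = fw b} s s≁e fwd≁rev-fwd)

      record Occurrence (e : Transition) (Y Z : Proc) : Set where
        field
          {from to} : Proc
          {lab} : Lab
          before : Y ⇝ from
          step : Fwd from lab to
          step∼e : (from , fw lab , to) ∼ e
          not-yet : ¬ Happened e from
          after : to ⇝ Z

      first-occurrence : Y ⇝ Z → ¬ Happened (P , fw a , Q) Y → Happened (P , fw a , Q) Z →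
                         Occurrence (P , fw a , Q) Y Z
      first-occurrence [] ¬h h = ⊥-elim (¬h h)
      first-occurrence {Y} {P = P} {a} {Q} (_∷_ {a = b} {Y = Y₁} s f) ¬h h =
        case em {(Y , fw b , Y₁) ∼ (P , fw a , Q)} of λ where
          (yes s∼e) → record { before = [] ; step = s ; step∼e = s∼e ; not-yet = ¬h ; after = f }
          (no s≁e)  → let open Occurrence (first-occurrence f (¬h ∘ happened-before s s≁e) h)
                      in record { before = s ∷ before ; step = step ; step∼e = step∼e
                                ; not-yet = not-yet ; after = after }

      first-occurrence-rooted : Happened (P , fw a , Q) X → Occurrence (P , fw a , Q) (Rooted.root (rooted wf X)) X
      first-occurrence-rooted {X = X} =
        first-occurrence (Rooted.path (rooted wf X)) (root-not-happened (Rooted.root-irreversible (rooted wf X)))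

      source-not-happened : Fwd X b Y → (X , fw b , Y) ∼ (P , fw a , Q) → ¬ Happened (P , fw a , Q) X
      source-not-happened s s∼e h with first-occurrence-rooted (happened-after s s∼e)
      ... | record { step∼e = s₁∼e ; not-yet = ¬h₁ } =
        ¬h₁ (subst (+ 0 <_) (countAt-src-∼ (ιc-irrefl sp pci) s∼e (∼trans s∼e (∼sym s₁∼e))) h)

      Pos⇒happened : Irreversible O → (r : Path O X) → Pos r e → Happened e X
      Pos⇒happened irr r pos = subst (+ 0 <_) (countAt-rooted irr r) (Pos⇒0<count r pos)

      happened⇒Pos : Irreversible O → (r : Path O X) → Happened e X → Pos r e
      happened⇒Pos irr r h = 0<count⇒Pos r (subst (+ 0 <_) (sym (countAt-rooted irr r)) h)

      ≤ₑ⇒happened : e ≤ₑ e′ → Happened e′ X → Happened e X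
      ≤ₑ⇒happened {X = X} e≤e′ h′ =
        let rooted-by irr f = rooted wf X
        in Pos⇒happened irr (⇝⇒Path f) (e≤e′ _ X irr (⇝⇒Path f) (happened⇒Pos irr (⇝⇒Path f) h′))

      happened⇒¬# : Happened e X → Happened e′ X → ¬ (e # e′)
      happened⇒¬# {X = X} h h′ e#e′ =
        let rooted-by irr f = rooted wf X
        in e#e′ (_ , X , ⇝⇒Path f , irr , happened⇒Pos irr (⇝⇒Path f) h , happened⇒Pos irr (⇝⇒Path f) h′)

      ¬#⇒happened : ¬ (e # e′) → Σ Proc λ X → Happened e X × Happened e′ X
      ¬#⇒happened ¬e#e′ =
        let (_ , X , r , irr , pos , pos′) = decidable-stable em ¬e#e′
        in X , Pos⇒happened irr r pos , Pos⇒happened irr r pos′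

      ¬≤ₑ⇒happened : ¬ (e ≤ₑ e′) → Σ Proc λ X → Happened e′ X × ¬ Happened e X
      ¬≤ₑ⇒happened {e} ¬e≤e′ = decidable-stable em λ ¬witness → ¬e≤e′ λ _ X irr r pos′ →
        happened⇒Pos irr r (decidable-stable (happened? e X) λ ¬h →
          ¬witness (X , Pos⇒happened irr r pos′ , ¬h))

      -- Where e has occurred without e′ (¬ e′ ≤ₑ e), e′ has not happened before that
      -- occurrence; by countAt-src-∼ this holds at the source of every occurrence of e.
      ¬≤ₑ⇒source-not-happened : ¬ ((P′ , fw a′ , Q′) ≤ₑ (P , fw a , Q)) → ¬ ((P , fw a , Q) ιc (P′ , fw a′ , Q′)) →
                                Fwd X b Y → (X , fw b , Y) ∼ (P , fw a , Q) → ¬ Happened (P′ , fw a′ , Q′) X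
      ¬≤ₑ⇒source-not-happened ¬e′≤e ¬ι s s∼e h′ with ¬≤ₑ⇒happened ¬e′≤e
      ... | Z , h , ¬h′ with first-occurrence-rooted h
      ... | record { step = s₁ ; step∼e = s₁∼e ; after = f₁ } =
        ¬h′ (happened-mono (s₁ ∷ f₁) (subst (+ 0 <_) (countAt-src-∼ ¬ι s∼e (∼trans s∼e (∼sym s₁∼e))) h′))

      ∼⇒¬# : Fwd P a Q → (P , fw a , Q) ∼ (P′ , fw a′ , Q′) → ¬ ((P , fw a , Q) # (P′ , fw a′ , Q′))
      ∼⇒¬# t e∼e′ = happened⇒¬# (happened-after t ∼refl) (happened-after t e∼e′)

      <ₑ⇒¬≥ₑ : Fwd P a Q → (P , fw a , Q) <ₑ (P′ , fw a′ , Q′) → ¬ ((P′ , fw a′ , Q′) ≤ₑ (P , fw a , Q))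
      <ₑ⇒¬≥ₑ t (e≤e′ , e≁e′) e′≤e =
        source-not-happened t ∼refl
          (≤ₑ⇒happened e≤e′ (happened-before t e≁e′ (≤ₑ⇒happened e′≤e (happened-after t ∼refl))))

      ≤ₑ⇒¬# : Fwd P′ a′ Q′ → (P , fw a , Q) ≤ₑ (P′ , fw a′ , Q′) → ¬ ((P , fw a , Q) # (P′ , fw a′ , Q′))
      ≤ₑ⇒¬# t′ e≤e′ = happened⇒¬# (≤ₑ⇒happened e≤e′ (happened-after t′ ∼refl)) (happened-after t′ ∼refl)

      ≤ₑ⇒¬ιc : (P , fw a , Q) ≤ₑ (P′ , fw a′ , Q′) → ¬ ((P , fw a , Q) ιc (P′ , fw a′ , Q′))
      ≤ₑ⇒¬ιc e≤e′ (P₀ , α , Q₀ , β , R₀ , t , u , t∼e , u∼e′ , i) with ∼-label t∼e | ∼-label u∼e′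
      ... | refl | refl =
        source-not-happened t t∼e (happened-before u u≁e (≤ₑ⇒happened e≤e′ (happened-after u u∼e′)))
        where
          u≁e : ¬ (P₀ , β , R₀) ∼ _
          u≁e u∼e = ιc-irrefl sp pci (P₀ , α , Q₀ , β , R₀ , t , u , t∼e , u∼e , i)

      ιc⇒¬# : (P , fw a , Q) ιc (P′ , fw a′ , Q′) → ¬ ((P , fw a , Q) # (P′ , fw a′ , Q′))
      ιc⇒¬# (P₀ , α , Q₀ , β , R₀ , t , u , t∼e , u∼e′ , i) with ∼-label t∼e | ∼-label u∼e′
      ... | refl | refl =
        let open Square (square {P₀} {α} {Q₀} {β} {R₀} t u i)
        in happened⇒¬# (happened-mono (u′ ∷ []) (happened-after t t∼e)) (happened-after u′ (∼trans (∼sym u∼u′) u∼e′))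

      -- Along a rooted path to a process where both have happened, look at the first
      -- occurrence s of e: either e′ has happened before s, or the first occurrence
      -- of e′ comes after s.
      unordered-absurd : ¬ (P , fw a , Q) ∼ (P′ , fw a′ , Q′) → ¬ ((P , fw a , Q) ιc (P′ , fw a′ , Q′)) →
                         ¬ ((P , fw a , Q) # (P′ , fw a′ , Q′)) →
                         ¬ ((P , fw a , Q) ≤ₑ (P′ , fw a′ , Q′)) → ¬ ((P′ , fw a′ , Q′) ≤ₑ (P , fw a , Q)) → ⊥
      unordered-absurd ¬e∼e′ ¬ι ¬e#e′ ¬e≤e′ ¬e′≤e with ¬#⇒happened ¬e#e′
      ... | X , h , h′ with first-occurrence-rooted h
      ... | record { from = Y ; step = s ; step∼e = s∼e ; after = f₁ } with happened? _ Y
      ... | yes h′Y = ¬≤ₑ⇒source-not-happened ¬e′≤e ¬ι s s∼e h′Y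
      ... | no ¬h′Y with first-occurrence f₁ (¬h′Y ∘ happened-before s (¬e∼e′ ∘ ∼trans (∼sym s∼e))) h′
      ... | record { before = f₂ ; step = s′ ; step∼e = s′∼e′ } =
        ¬≤ₑ⇒source-not-happened ¬e≤e′ (¬ι ∘ ιc-sym) s′ s′∼e′ (happened-mono f₂ (happened-after s s∼e))

      classify : (P , fw a , Q) ∼ (P′ , fw a′ , Q′) ⊎ (P , fw a , Q) <ₑ (P′ , fw a′ , Q′) ⊎
                 (P′ , fw a′ , Q′) <ₑ (P , fw a , Q) ⊎ (P , fw a , Q) # (P′ , fw a′ , Q′) ⊎
                 (P , fw a , Q) ιc (P′ , fw a′ , Q′)
      classify {P} {a} {Q} {P′} {a′} {Q′}
        with em {(P , fw a , Q) ∼ (P′ , fw a′ , Q′)} | em {(P , fw a , Q) ιc (P′ , fw a′ , Q′)}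
           | em {(P , fw a , Q) # (P′ , fw a′ , Q′)}
           | em {(P , fw a , Q) ≤ₑ (P′ , fw a′ , Q′)} | em {(P′ , fw a′ , Q′) ≤ₑ (P , fw a , Q)}
      ... | yes e∼e′ | _      | _     | _      | _       = inj₁ e∼e′
      ... | no _     | yes ι′ | _     | _      | _       = inj₂ (inj₂ (inj₂ (inj₂ ι′)))
      ... | no _     | no _   | yes h | _      | _       = inj₂ (inj₂ (inj₂ (inj₁ h)))
      ... | no e≁e′  | no _   | no _  | yes le | _       = inj₂ (inj₁ (le , e≁e′))
      ... | no e≁e′  | no _   | no _  | no _   | yes le′ = inj₂ (inj₂ (inj₁ (le′ , e≁e′ ∘ ∼sym)))
      ... | no e≁e′  | no ¬ι  | no ¬h | no ¬le | no ¬le′ = ⊥-elim (unordered-absurd e≁e′ ¬ι ¬h ¬le ¬le′)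

proposition4p29 : ExcludedMiddle 0ℓ → (L : LTSI) → LTSI.PreReversible L →
    let open LTSI L in
    ∀ P a Q P' a' Q' → Fwd P a Q → Fwd P' a' Q' →
    ExactlyOne5 ((P , fw a , Q) ∼ (P' , fw a' , Q'))
                ((P , fw a , Q) <ₑ (P' , fw a' , Q'))
                ((P' , fw a' , Q') <ₑ (P , fw a , Q))
                ((P , fw a , Q) # (P' , fw a' , Q'))
                ((P , fw a , Q) ιc (P' , fw a' , Q'))
proposition4p29 em L (sp , bti , wf , pci) P a Q P′ a′ Q′ t t′ =
  classify ,
  (λ (e∼e′ , _ , e≁e′) → e≁e′ e∼e′) ,
  (λ (e∼e′ , _ , e′≁e) → e′≁e (∼sym e∼e′)) ,
  uncurry (∼⇒¬# t) ,
  uncurry (∼⇒¬ιc sp pci) ,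
  (λ (e<e′ , (e′≤e , _)) → <ₑ⇒¬≥ₑ t e<e′ e′≤e) ,
  (λ ((e≤e′ , _) , e#e′) → ≤ₑ⇒¬# t′ e≤e′ e#e′) ,
  (λ ((e≤e′ , _) , ι) → ≤ₑ⇒¬ιc e≤e′ ι) ,
  (λ ((e′≤e , _) , e#e′) → ≤ₑ⇒¬# t e′≤e (#-sym e#e′)) ,
  (λ ((e′≤e , _) , ι) → ≤ₑ⇒¬ιc e′≤e (ιc-sym ι)) ,
  (λ (e#e′ , ι) → ιc⇒¬# ι e#e′)
  where
    open LTSI L
    open Events L
    open Classification em sp bti wf pci
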